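{- Let $n,w\ge1$ be integers and let $\mathrm{CDP}(n,w)$ be the set of integer sequences $(a_1,\dots,a_n)$ such that $0\le a_i\le w-1$ for all $i$ and $a_{i+1}\le a_i+1$ for all $1\le i\le n$, where $a_{n+1}:=a_1$. Then \[ |\mathrm{CDP}(n,w)|=(w+2)\sum_{t\in\mathbb Z}\binom{2n-1}{n+(w+2)t}-\sum_{t\in\mathbb Z}\binom{2n-1}{n+t}=(w+2)\sum_{t\in\mathbb Z}\binom{2n-1}{n+(w+2)t}-2^{2n-1}. \]
   Context: Binomial coefficients $\binom{N}{k}$ are $0$ when $k<0$ or $k>N$. -}

module Defs where

open import Data.Nat using (ℕ; zero; suc; _+_; _≤_; _<_)
open import Data.Nat.DivMod using (_mod_)
open import Data.Nat.Combinatorics using (_C_)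
open import Data.Integer using (ℤ; +_; -[1+_])
open import Data.Fin using (Fin; toℕ)
open import Data.Vec using (Vec; lookup; allFin)
open import Data.Vec.Relation.Unary.All using (All)
open import Data.List using (List; map; upTo; _++_)
open import Data.Nat.ListAction using (sum)
open import Data.Product using (Σ; _×_)

-- successor index modulo n (index i ↦ i+1, last index ↦ first), so that a_{n+1} := a_1
next : ∀ {n} → Fin n → Fin n
next {suc k} i = suc (toℕ i) mod suc k

-- membership predicate for CDP(n,w): a sequence (a_1,…,a_n) of naturals
-- (naturals = integers ≥ 0) with a_i ≤ w-1 (i.e. a_i < w) and a_{i+1} ≤ a_i + 1 cyclically.
-- Inductive All-predicates are used so that the proof component is unique.
IsCDP : (n w : ℕ) → Vec ℕ n → Set
IsCDP n w a =
  All (λ x → x < w) a ×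
  All (λ i → lookup a (next i) ≤ suc (lookup a i)) (allFin n)

CDP : (n w : ℕ) → Set
CDP n w = Σ (Vec ℕ n) (IsCDP n w)

-- binomial coefficient with integer lower index, 0 for k < 0 (and N C k = 0 for k > N)
binomℤ : ℕ → ℤ → ℕ
binomℤ N (+ k) = N C k
binomℤ N -[1+ _ ] = 0

symRange : ℕ → List ℤ
symRange B = map +_ (upTo (suc B)) ++ map -[1+_] (upTo B)

sumRange : ℕ → (ℤ → ℕ) → ℕ
sumRange B f = sum (map f (symRange B))

module Submission where

-- For a modulus m ≥ 1 let B(L, c) = Σ_{t ∈ ℤ} C(L, c + m t) be the sum of the binomial
-- coefficients C(L, ·) over one residue class (module ResidueSums).  These sums obey
-- Pascal's rule B(L+1, c) = B(L, c) + B(L, c-1), the symmetry B(L, c) = B(L, L-c),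
-- the periodicity B(L, c+m) = B(L, c), and any m consecutive classes add up to 2^L.
--
-- Now take m = w + 2 (module Chains).  A sequence in CDP(k+1, w) is its first entry
-- x < w together with a chain x → z₁ → … → z_k → x of entries in [0, w) whose steps
-- go up by at most one.  The number chains k x y of such chains from x to y obeys the
-- reflection formula chains k x y = B(L, k) - B(L, k-y-1) with L = 2k+1+x-y, proved
-- by induction on k: summing the formula over the next entry telescopes by Pascal's
-- rule.  For y = x, summing over x < w and using the window of classes k+1, …, k-w
-- gives |CDP(k+1, w)| = (w+2) B(2k+1, k) - 2^(2k+1) (module ClosedChains); the
-- bijection with Fin is assembled in module Enumeration.  Finally the two sums of
-- the statement are B(2n-1, n) for the moduli w+2 and 1, the latter being 2^(2n-1).

open import Defs
open import Data.Nat using (ℕ; _≤_; _∸_; _^_) renaming (_+_ to _+ℕ_; _*_ to _*ℕ_)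
open import Data.Integer using (ℤ; +_; _+_; _-_; _*_)
open import Data.Fin using (Fin)
open import Data.Product using (Σ; _×_)
open import Function.Bundles using (_↔_)
open import Relation.Binary.PropositionalEquality using (_≡_)

open import Data.Empty using (⊥-elim)
open import Data.Fin using (zero; suc; toℕ; fromℕ; inject₁)
import Data.Fin.Properties as FP
open import Data.Fin.Properties using (+↔⊎; *↔×)
import Data.Fin.Relation.Unary.Top as Top
open import Data.Integer using (-[1+_]; -_)
import Data.Integer as Z
import Data.Integer.Properties as ZP
open import Data.Integer.Tactic.RingSolver using (solve-∀)
open import Data.List using (map; upTo; _++_; applyUpTo)
import Data.List.Properties as LP
open import Data.Nat using (zero; suc; z≤n; s≤s; _⊓_)
import Data.Nat as N
open import Data.Nat.Combinatorics using (_C_; k>n⇒nCk≡0; nCk≡nC[n∸k]; nCk+nC[k+1]≡[n+1]C[k+1])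
open import Data.Nat.DivMod using (_%_; n%n≡0; m<n⇒m%n≡m)
open import Data.Nat.ListAction using (sum)
open import Data.Nat.ListAction.Properties using (sum-++)
import Data.Nat.Properties as NP
open import Data.Nat.Solver using (module +-*-Solver)
open import Algebra.Properties.CommutativeSemigroup NP.+-commutativeSemigroup using (interchange)
open import Data.Product using (_,_)
open import Data.Sum using (_⊎_; inj₁; inj₂)
open import Data.Sum.Function.Propositional using (_⊎-↔_)
open import Data.Product.Function.NonDependent.Propositional using (_×-↔_)
open import Data.Vec using (Vec; []; _∷_; lookup; allFin; _∷ʳ_)
open import Data.Vec.Relation.Unary.All using (All; []; _∷_)
import Data.Vec.Relation.Unary.All as All
import Data.Vec.Relation.Unary.All.Properties as AllP
open import Function.Bundles using (mk↔ₛ′)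
open import Function.Properties.Inverse using (↔-trans; ↔-sym)
open import Relation.Binary.PropositionalEquality
  using (refl; sym; trans; cong; cong₂; subst; subst₂; module ≡-Reasoning)
open import Relation.Nullary using (Dec; yes; no; Irrelevant)

Σ< : ℕ → (ℕ → ℕ) → ℕ
Σ< zero g = 0
Σ< (suc k) g = g 0 +ℕ Σ< k (λ i → g (suc i))

Σ<-cong : ∀ k {f g : ℕ → ℕ} → (∀ i → i N.< k → f i ≡ g i) → Σ< k f ≡ Σ< k g
Σ<-cong zero h = refl
Σ<-cong (suc k) h = cong₂ _+ℕ_ (h 0 (s≤s z≤n)) (Σ<-cong k (λ i p → h (suc i) (s≤s p)))

Σ<-const : ∀ k c → Σ< k (λ _ → c) ≡ k *ℕ c
Σ<-const zero c = refl
Σ<-const (suc k) c = cong (c +ℕ_) (Σ<-const k c)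

Σ<-vanish : ∀ k {f : ℕ → ℕ} → (∀ i → i N.< k → f i ≡ 0) → Σ< k f ≡ 0
Σ<-vanish k h = trans (Σ<-cong k h) (trans (Σ<-const k 0) (NP.*-zeroʳ k))

Σ<-last : ∀ k (g : ℕ → ℕ) → Σ< (suc k) g ≡ Σ< k g +ℕ g k
Σ<-last zero g = NP.+-comm (g 0) 0
Σ<-last (suc k) g = trans (cong (g 0 +ℕ_) (Σ<-last k (λ i → g (suc i))))
                          (sym (NP.+-assoc (g 0) _ _))

Σ<-+ : ∀ k (f g : ℕ → ℕ) → Σ< k (λ i → f i +ℕ g i) ≡ Σ< k f +ℕ Σ< k g
Σ<-+ zero f g = refl
Σ<-+ (suc k) f g = trans (cong (f 0 +ℕ g 0 +ℕ_) (Σ<-+ k _ _)) (interchange (f 0) (g 0) _ _)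

Σ<-rotate : ∀ k (h : ℕ → ℕ) → Σ< k (λ i → h (suc i)) +ℕ h 0 ≡ Σ< k h +ℕ h k
Σ<-rotate k h = trans (NP.+-comm _ (h 0)) (Σ<-last k h)

indicator : ∀ {P : Set} → Dec P → ℕ
indicator (yes _) = 1
indicator (no _) = 0

indicator-⇔ : ∀ {P Q : Set} → (P → Q) → (Q → P) → (d : Dec P) (e : Dec Q) → indicator d ≡ indicator e
indicator-⇔ f g (yes p) (yes q) = refl
indicator-⇔ f g (yes p) (no ¬q) = ⊥-elim (¬q (f p))
indicator-⇔ f g (no ¬p) (yes q) = ⊥-elim (¬p (g q))
indicator-⇔ f g (no ¬p) (no ¬q) = refl

Σ<-indicator : ∀ k b (g : ℕ → ℕ) → Σ< k (λ z → indicator (z N.≤? b) *ℕ g z) ≡ Σ< (suc b ⊓ k) g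
Σ<-indicator zero b g = refl
Σ<-indicator (suc k) zero g = cong₂ _+ℕ_ (NP.+-identityʳ (g 0)) (Σ<-vanish k (λ i _ → refl))
Σ<-indicator (suc k) (suc b) g =
  cong₂ _+ℕ_ (NP.+-identityʳ (g 0)) (trans (Σ<-cong k shift) (Σ<-indicator k b (λ i → g (suc i))))
  where
  shift : ∀ i → i N.< k →
          indicator (suc i N.≤? suc b) *ℕ g (suc i) ≡ indicator (i N.≤? b) *ℕ g (suc i)
  shift i _ = cong (_*ℕ g (suc i)) (indicator-⇔ N.s≤s⁻¹ s≤s (suc i N.≤? suc b) (i N.≤? b))

symSum : ℕ → (ℤ → ℕ) → ℕ
symSum zero f = f (+ 0)
symSum (suc K) f = symSum K f +ℕ (f (+ suc K) +ℕ f -[1+ K ])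

sumRange≡symSum : ∀ K f → sumRange K f ≡ symSum K f
sumRange≡symSum K f = begin
    sum (map f (map +_ (upTo (suc K)) ++ map -[1+_] (upTo K)))
  ≡⟨ cong sum (LP.map-++ f (map +_ (upTo (suc K))) _) ⟩
    sum (map f (map +_ (upTo (suc K))) ++ map f (map -[1+_] (upTo K)))
  ≡⟨ sum-++ (map f (map +_ (upTo (suc K)))) _ ⟩
    sum (map f (map +_ (upTo (suc K)))) +ℕ sum (map f (map -[1+_] (upTo K)))
  ≡⟨ cong₂ _+ℕ_ (sum-upTo (suc K) (λ i → + i) {λ i → i}) (sum-upTo K -[1+_] {λ i → i}) ⟩
    Σ< (suc K) (λ i → f (+ i)) +ℕ Σ< K (λ i → f -[1+ i ])
  ≡⟨ halves K f ⟩
    symSum K f ∎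
  where
  open ≡-Reasoning
  sum-upTo : ∀ k (e : ℕ → ℤ) {h : ℕ → ℕ} →
             sum (map f (map e (applyUpTo h k))) ≡ Σ< k (λ i → f (e (h i)))
  sum-upTo zero e = refl
  sum-upTo (suc k) e {h} = cong (f (e (h 0)) +ℕ_) (sum-upTo k e {λ i → h (suc i)})
  halves : ∀ K (f : ℤ → ℕ) → Σ< (suc K) (λ i → f (+ i)) +ℕ Σ< K (λ i → f -[1+ i ]) ≡ symSum K f
  halves zero f = trans (NP.+-identityʳ _) (NP.+-identityʳ _)
  halves (suc K) f = begin
      Σ< (suc (suc K)) (λ i → f (+ i)) +ℕ Σ< (suc K) (λ i → f -[1+ i ])
    ≡⟨ cong₂ _+ℕ_ (Σ<-last (suc K) (λ i → f (+ i))) (Σ<-last K (λ i → f -[1+ i ])) ⟩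
      (Σ< (suc K) (λ i → f (+ i)) +ℕ f (+ suc K)) +ℕ (Σ< K (λ i → f -[1+ i ]) +ℕ f -[1+ K ])
    ≡⟨ interchange (Σ< (suc K) (λ i → f (+ i))) (f (+ suc K)) _ _ ⟩
      (Σ< (suc K) (λ i → f (+ i)) +ℕ Σ< K (λ i → f -[1+ i ])) +ℕ (f (+ suc K) +ℕ f -[1+ K ])
    ≡⟨ cong (_+ℕ (f (+ suc K) +ℕ f -[1+ K ])) (halves K f) ⟩
      symSum (suc K) f ∎

symSum-cong : ∀ K {f g : ℤ → ℕ} → (∀ t → f t ≡ g t) → symSum K f ≡ symSum K g
symSum-cong zero h = h (+ 0)
symSum-cong (suc K) h = cong₂ _+ℕ_ (symSum-cong K h) (cong₂ _+ℕ_ (h _) (h _))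

symSum-+ : ∀ K (f g : ℤ → ℕ) → symSum K (λ t → f t +ℕ g t) ≡ symSum K f +ℕ symSum K g
symSum-+ zero f g = refl
symSum-+ (suc K) f g =
  trans (cong₂ _+ℕ_ (symSum-+ K f g) (interchange (f (+ suc K)) (g (+ suc K)) (f -[1+ K ]) (g -[1+ K ])))
        (interchange (symSum K f) (symSum K g) _ _)

symSum-neg : ∀ K (f : ℤ → ℕ) → symSum K (λ t → f (- t)) ≡ symSum K f
symSum-neg zero f = refl
symSum-neg (suc K) f = cong₂ _+ℕ_ (symSum-neg K f) (NP.+-comm (f -[1+ K ]) (f (+ suc K)))

symSum-single : ∀ K (f : ℤ → ℕ) → (∀ i → f (+ suc i) ≡ 0) → (∀ i → f -[1+ i ] ≡ 0) →
                symSum K f ≡ f (+ 0)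
symSum-single zero f pos neg = refl
symSum-single (suc K) f pos neg rewrite symSum-single K f pos neg | pos K | neg K = NP.+-identityʳ _

symSum-shift : ∀ K (f : ℤ → ℕ) →
               symSum K (λ t → f (+ 1 + t)) +ℕ f (- (+ K)) ≡ symSum K f +ℕ f (+ suc K)
symSum-shift zero f = NP.+-comm (f (+ 1)) (f (+ 0))
symSum-shift (suc K) f = begin
    symSum K g +ℕ (f (+ suc (suc K)) +ℕ g -[1+ K ]) +ℕ f -[1+ K ]
  ≡⟨ cong (λ u → symSum K g +ℕ (f (+ suc (suc K)) +ℕ u) +ℕ f -[1+ K ]) (cong f (one+neg K)) ⟩
    symSum K g +ℕ (f (+ suc (suc K)) +ℕ f (- (+ K))) +ℕ f -[1+ K ]
  ≡⟨ regroup₁ (symSum K g) _ _ _ ⟩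
    (symSum K g +ℕ f (- (+ K))) +ℕ f (+ suc (suc K)) +ℕ f -[1+ K ]
  ≡⟨ cong (λ u → u +ℕ f (+ suc (suc K)) +ℕ f -[1+ K ]) (symSum-shift K f) ⟩
    symSum K f +ℕ f (+ suc K) +ℕ f (+ suc (suc K)) +ℕ f -[1+ K ]
  ≡⟨ regroup₂ (symSum K f) _ _ _ ⟩
    symSum K f +ℕ (f (+ suc K) +ℕ f -[1+ K ]) +ℕ f (+ suc (suc K)) ∎
  where
  open ≡-Reasoning
  g : ℤ → ℕ
  g t = f (+ 1 + t)
  one+neg : ∀ K → + 1 + -[1+ K ] ≡ - (+ K)
  one+neg zero = refl
  one+neg (suc K) = refl
  open +-*-Solver
  regroup₁ : ∀ a b c d → a +ℕ (b +ℕ c) +ℕ d ≡ a +ℕ c +ℕ b +ℕ d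
  regroup₁ = solve 4 (λ a b c d → a :+ (b :+ c) :+ d := a :+ c :+ b :+ d) refl
  regroup₂ : ∀ a b c d → a +ℕ b +ℕ c +ℕ d ≡ a +ℕ (b +ℕ d) +ℕ c
  regroup₂ = solve 4 (λ a b c d → a :+ b :+ c :+ d := a :+ (b :+ d) :+ c) refl

pos-∸ : ∀ {a y} → y ≤ a → + a - + y ≡ + (a ∸ y)
pos-∸ {a} {y} p = trans (ZP.m-n≡m⊖n a y) (ZP.⊖-≥ p)

binomℤ-neg : ∀ L {k} → k Z.< + 0 → binomℤ L k ≡ 0
binomℤ-neg L { -[1+ j ]} _ = refl
binomℤ-neg L {+ j} (Z.+<+ ())

binomℤ-big : ∀ L {k} → + L Z.< k → binomℤ L k ≡ 0
binomℤ-big L {+ j} (Z.+<+ p) = k>n⇒nCk≡0 p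

binomℤ-pascal : ∀ L k → binomℤ (suc L) k ≡ binomℤ L k +ℕ binomℤ L (k - + 1)
binomℤ-pascal L (+ zero) = refl
binomℤ-pascal L (+ suc j) = trans (sym (nCk+nC[k+1]≡[n+1]C[k+1] L j)) (NP.+-comm (L C j) (L C suc j))
binomℤ-pascal L -[1+ j ] = refl

binomℤ-sym : ∀ L k → binomℤ L k ≡ binomℤ L (+ L - k)
binomℤ-sym L (+ j) with j N.≤? L
... | yes j≤L = trans (nCk≡nC[n∸k] j≤L) (cong (binomℤ L) (sym (pos-∸ j≤L)))
... | no j≰L = trans (k>n⇒nCk≡0 L<j) (sym (binomℤ-neg L (subst (Z._< + 0) (sym L-j) -[j∸L]<0)))
  where
  L<j : L N.< j
  L<j = NP.≰⇒> j≰L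
  L-j : + L - + j ≡ - + (j ∸ L)
  L-j = trans (ZP.m-n≡m⊖n L j) (ZP.⊖-< L<j)
  -[j∸L]<0 : - + (j ∸ L) Z.< + 0
  -[j∸L]<0 = ZP.neg-mono-< (Z.+<+ (NP.m<n⇒0<n∸m L<j))
binomℤ-sym L -[1+ j ] = sym (k>n⇒nCk≡0 (NP.m<m+n L {suc j} (s≤s z≤n)))

≤-by : ∀ {i j : ℤ} (d : ℕ) → j ≡ i + + d → i Z.≤ j
≤-by {i} d eq = subst (i Z.≤_) (sym eq) (ZP.i≤i+j i (+ d))

<⇒sub<0 : ∀ {x : ℤ} M → x Z.< + M → x - + M Z.< + 0
<⇒sub<0 {x} M p = subst (x - + M Z.<_) (ZP.+-inverseʳ (+ M)) (ZP.+-monoˡ-< (- + M) p)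

*-neg : ∀ m K → + m * -[1+ K ] ≡ - + (m *ℕ suc K)
*-neg m K = sym (trans (cong -_ (ZP.pos-* m (suc K))) (ZP.neg-distribʳ-* (+ m) (+ suc K)))

<-neg+ : ∀ L a M → L +ℕ suc a N.< M → + L Z.< -[1+ a ] + + M
<-neg+ L a M p = subst (+ L Z.<_) (sym (trans (ZP.+-comm -[1+ a ] (+ M)) (ZP.⊖-≥ a<M)))
                   (Z.+<+ (NP.m+n≤o⇒m≤o∸n (suc L) p))
  where
  a<M : suc a ≤ M
  a<M = NP.≤-trans (NP.m≤n+m (suc a) L) (NP.<⇒≤ p)

module ResidueSums (m : ℕ) (m≥1 : 1 ≤ m) where

  term : ℕ → ℤ → ℤ → ℕ
  term L c t = binomℤ L (c + + m * t)

  truncated : ℕ → ℕ → ℤ → ℕ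
  truncated K L c = symSum K (term L c)

  -- m (K + 1), the distance from c to the first members of its class outside [-K, K]
  reach : ℕ → ℕ
  reach K = m *ℕ suc K

  reach≥ : ∀ K → suc K ≤ reach K
  reach≥ K = NP.m≤n*m (suc K) m {{N.>-nonZero m≥1}}

  -- K covers [0, L] for the class of c when c - m(K+1) < 0 and L < c + m(K+1):
  -- then every term with |t| > K vanishes.
  Covers : ℕ → ℕ → ℤ → Set
  Covers K L c = (c Z.< + reach K) × (+ L Z.< c + + reach K)

  edge-pos : ∀ {K L c} → Covers K L c → term L c (+ suc K) ≡ 0
  edge-pos {K} {L} {c} (_ , above) =
    binomℤ-big L (subst (+ L Z.<_) (cong (λ u → c + u) (ZP.pos-* m (suc K))) above)

  edge-neg : ∀ {K L c} → Covers K L c → term L c -[1+ K ] ≡ 0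
  edge-neg {K} {L} {c} (below , _) =
    binomℤ-neg L (subst (Z._< + 0) (cong (λ u → c + u) (sym (*-neg m K))) (<⇒sub<0 (reach K) below))

  Covers-mono : ∀ {K K' L c} → K ≤ K' → Covers K L c → Covers K' L c
  Covers-mono {K} {K'} {c = c} p (below , above) =
    ZP.<-≤-trans below reach-mono , ZP.<-≤-trans above (ZP.+-monoʳ-≤ c reach-mono)
    where
    reach-mono : + reach K Z.≤ + reach K'
    reach-mono = Z.+≤+ (NP.*-monoʳ-≤ m (s≤s p))

  truncated-stable : ∀ {K L c} → Covers K L c → ∀ d → truncated (d +ℕ K) L c ≡ truncated K L c
  truncated-stable cov zero = refl
  truncated-stable {K} {L} {c} cov (suc d) = begin
      truncated (d +ℕ K) L c +ℕ (term L c (+ suc (d +ℕ K)) +ℕ term L c -[1+ d +ℕ K ])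
    ≡⟨ cong₂ (λ a b → truncated (d +ℕ K) L c +ℕ (a +ℕ b)) (edge-pos cov') (edge-neg cov') ⟩
      truncated (d +ℕ K) L c +ℕ 0
    ≡⟨ NP.+-identityʳ _ ⟩
      truncated (d +ℕ K) L c
    ≡⟨ truncated-stable cov d ⟩
      truncated K L c ∎
    where
    open ≡-Reasoning
    cov' : Covers (d +ℕ K) L c
    cov' = Covers-mono (NP.m≤n+m K d) cov

  covers-wide : ∀ K L a → a ≤ K → L ≤ K → Covers K L (+ a)
  covers-wide K L a a≤K L≤K =
    Z.+<+ (NP.<-≤-trans (s≤s a≤K) (reach≥ K)) ,
    Z.+<+ (NP.<-≤-trans (s≤s L≤K) (NP.≤-trans (reach≥ K) (NP.m≤n+m _ a)))

  radius : ℕ → ℤ → ℕ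
  radius L c = L +ℕ Z.∣ c ∣

  covers-radius : ∀ L c → Covers (radius L c) L c
  covers-radius L (+ a) = covers-wide (L +ℕ a) L a (NP.m≤n+m a L) (NP.m≤m+n L a)
  covers-radius L -[1+ a ] = Z.-<+ , <-neg+ L a (reach (L +ℕ suc a)) (reach≥ (L +ℕ suc a))

  -- B L c = Σ_{t ∈ ℤ} C(L, c + m t).
  B : ℕ → ℤ → ℕ
  B L c = truncated (radius L c) L c

  truncated≡B : ∀ {K L c} → Covers K L c → truncated K L c ≡ B L c
  truncated≡B {K} {L} {c} cov with NP.≤-total K (radius L c)
  ... | inj₁ p = sym (trans (cong (λ k → truncated k L c) (sym (NP.m∸n+n≡m p)))
                            (truncated-stable cov (radius L c ∸ K)))
  ... | inj₂ p = trans (cong (λ k → truncated k L c) (sym (NP.m∸n+n≡m p)))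
                       (truncated-stable (covers-radius L c) (K ∸ radius L c))

  Covers-predL : ∀ {K L c} → Covers K (suc L) c → Covers K L c
  Covers-predL {L = L} (below , above) = below , ZP.<-trans (Z.+<+ (NP.n<1+n L)) above

  Covers-predc : ∀ {K L c} → Covers K (suc L) c → Covers K L (c - + 1)
  Covers-predc {K} {L} {c} (below , above) =
    ZP.<-trans (subst (Z._<_ _) (ZP.+-identityʳ c) (ZP.+-monoʳ-< c Z.-<+)) below ,
    subst (Z._<_ _) (shift c (+ reach K)) (ZP.+-monoˡ-< (- + 1) above)
    where
    shift : ∀ c M → (c + M) - + 1 ≡ (c - + 1) + M
    shift = solve-∀

  Covers-reflect : ∀ {K L c} → Covers K L c → Covers K L (+ L - c)
  Covers-reflect {K} {L} {c} (below , above) =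
    subst (Z._<_ _) (cancel c (+ reach K)) (ZP.+-monoˡ-< (- c) above) ,
    subst₂ Z._<_ (restore c (+ L)) (swap c (+ L) (+ reach K)) (ZP.+-monoˡ-< (+ L - c) below)
    where
    cancel : ∀ c M → (c + M) - c ≡ M
    cancel = solve-∀
    restore : ∀ c L → c + (L - c) ≡ L
    restore = solve-∀
    swap : ∀ c L M → M + (L - c) ≡ (L - c) + M
    swap = solve-∀

  sumRange≡B : ∀ K L a → a ≤ K → L ≤ K → sumRange K (term L (+ a)) ≡ B L (+ a)
  sumRange≡B K L a a≤K L≤K =
    trans (sumRange≡symSum K (term L (+ a))) (truncated≡B (covers-wide K L a a≤K L≤K))

  B-pascal : ∀ L c → B (suc L) c ≡ B L c +ℕ B L (c - + 1)
  B-pascal L c = begin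
      symSum K (term (suc L) c)
    ≡⟨ symSum-cong K (λ t → trans (binomℤ-pascal L (c + + m * t))
                                   (cong (λ u → term L c t +ℕ binomℤ L u) (shift c (+ m) t))) ⟩
      symSum K (λ t → term L c t +ℕ term L (c - + 1) t)
    ≡⟨ symSum-+ K _ _ ⟩
      truncated K L c +ℕ truncated K L (c - + 1)
    ≡⟨ cong₂ _+ℕ_ (truncated≡B (Covers-predL cov)) (truncated≡B (Covers-predc cov)) ⟩
      B L c +ℕ B L (c - + 1) ∎
    where
    open ≡-Reasoning
    K : ℕ
    K = radius (suc L) c
    cov : Covers K (suc L) c
    cov = covers-radius (suc L) c
    shift : ∀ c M t → (c + M * t) - + 1 ≡ (c - + 1) + M * t
    shift = solve-∀

  B-sym : ∀ L c → B L c ≡ B L (+ L - c)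
  B-sym L c = begin
      symSum K (term L c)
    ≡⟨ symSum-cong K (λ t → trans (binomℤ-sym L (c + + m * t))
                                   (cong (binomℤ L) (reflect c (+ L) (+ m) t))) ⟩
      symSum K (λ t → term L (+ L - c) (- t))
    ≡⟨ symSum-neg K (term L (+ L - c)) ⟩
      truncated K L (+ L - c)
    ≡⟨ truncated≡B (Covers-reflect (covers-radius L c)) ⟩
      B L (+ L - c) ∎
    where
    open ≡-Reasoning
    K : ℕ
    K = radius L c
    reflect : ∀ c L M t → L - (c + M * t) ≡ (L - c) + M * (- t)
    reflect = solve-∀

  B-period : ∀ L c → B L (c + + m) ≡ B L c
  B-period L c = begin
      B L (c + + m)
    ≡⟨ sym (truncated≡B cov-m) ⟩
      truncated K L (c + + m)
    ≡⟨ symSum-cong K (λ t → cong (binomℤ L) (shift c (+ m) t)) ⟩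
      symSum K (λ t → f (+ 1 + t))
    ≡⟨ sym (NP.+-identityʳ _) ⟩
      symSum K (λ t → f (+ 1 + t)) +ℕ 0
    ≡⟨ cong (symSum K (λ t → f (+ 1 + t)) +ℕ_) (sym (edge-neg cov₁)) ⟩
      symSum K (λ t → f (+ 1 + t)) +ℕ f (- (+ K))
    ≡⟨ symSum-shift K f ⟩
      symSum K f +ℕ f (+ suc K)
    ≡⟨ cong (symSum K f +ℕ_) (edge-pos cov) ⟩
      symSum K f +ℕ 0
    ≡⟨ NP.+-identityʳ _ ⟩
      truncated K L c
    ≡⟨ truncated≡B cov ⟩
      B L c ∎
    where
    open ≡-Reasoning
    K₁ K : ℕ
    K₁ = radius L c +ℕ radius L (c + + m)
    K = suc K₁
    f : ℤ → ℕ
    f = term L c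
    cov₁ : Covers K₁ L c
    cov₁ = Covers-mono (NP.m≤m+n _ _) (covers-radius L c)
    cov : Covers K L c
    cov = Covers-mono (NP.n≤1+n K₁) cov₁
    cov-m : Covers K L (c + + m)
    cov-m = Covers-mono (NP.≤-trans (NP.m≤n+m (radius L (c + + m)) (radius L c)) (NP.n≤1+n K₁))
                        (covers-radius L (c + + m))
    shift : ∀ c M t → (c + M) + M * t ≡ c + M * (+ 1 + t)
    shift = solve-∀

  B-period⁻ : ∀ L c → B L (c - + m) ≡ B L c
  B-period⁻ L c = trans (sym (B-period L (c - + m))) (cong (B L) (cancel c (+ m)))
    where
    cancel : ∀ c M → (c - M) + M ≡ c
    cancel = solve-∀

  Outside : ℕ → ℤ → ℤ → Set
  Outside L c t = (c + + m * t Z.< + 0) ⊎ (+ L Z.< c + + m * t)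

  B-vanish : ∀ L c → (∀ t → Outside L c t) → B L c ≡ 0
  B-vanish L c outside =
    trans (symSum-single (radius L c) (term L c) (λ _ → zero-term _) (λ _ → zero-term _)) (zero-term (+ 0))
    where
    zero-term : ∀ t → term L c t ≡ 0
    zero-term t with outside t
    ... | inj₁ p = binomℤ-neg L p
    ... | inj₂ p = binomℤ-big L p

  member-pos : ∀ c j → c Z.≤ c + + m * + j
  member-pos c j = ≤-by (m *ℕ j) (cong (λ u → c + u) (sym (ZP.pos-* m j)))

  member-suc : ∀ c j → c + + m Z.≤ c + + m * + suc j
  member-suc c j =
    ≤-by (m *ℕ j) (trans (split c (+ m) (+ j)) (cong (λ u → (c + + m) + u) (sym (ZP.pos-* m j))))
    where
    split : ∀ c M J → c + M * (+ 1 + J) ≡ (c + M) + M * J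
    split = solve-∀

  member-neg : ∀ c j → c + + m * -[1+ j ] Z.≤ c - + m
  member-neg c j =
    ≤-by (m *ℕ j) (trans (split c (+ m) (+ j))
                         (cong (λ u → (c + + m * -[1+ j ]) + u) (sym (ZP.pos-* m j))))
    where
    split : ∀ c M J → c - M ≡ (c + M * (- (+ 1 + J))) + M * J
    split = solve-∀

  B-vanish-above : ∀ L a → L N.< a → a N.< m → B L (+ a) ≡ 0
  B-vanish-above L a L<a a<m = B-vanish L (+ a) outside
    where
    outside : ∀ t → Outside L (+ a) t
    outside (+ j) = inj₂ (ZP.<-≤-trans (Z.+<+ L<a) (member-pos (+ a) j))
    outside -[1+ j ] = inj₁ (ZP.≤-<-trans (member-neg (+ a) j) (<⇒sub<0 m (Z.+<+ a<m)))

  B-vanish-below : ∀ L a → L +ℕ suc a N.< m → B L -[1+ a ] ≡ 0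
  B-vanish-below L a small = B-vanish L -[1+ a ] outside
    where
    outside : ∀ t → Outside L -[1+ a ] t
    outside (+ zero) = inj₁ (subst (Z._< + 0) (sym (trans (cong (λ u → -[1+ a ] + u) (ZP.*-zeroʳ (+ m)))
                                                          (ZP.+-identityʳ _))) Z.-<+)
    outside (+ suc j) = inj₂ (ZP.<-≤-trans (<-neg+ L a m small) (member-suc -[1+ a ] j))
    outside -[1+ j ] = inj₁ (ZP.≤-<-trans (member-neg -[1+ a ] j)
                                          (ZP.≤-<-trans (ZP.i≤j⇒i-k≤j (+ m) ZP.≤-refl) Z.-<+))

  -- For L < m the class of 0 meets [0, L] only in 0.
  B-at-0 : ∀ L → L N.< m → B L (+ 0) ≡ 1
  B-at-0 L L<m = trans (symSum-single (radius L (+ 0)) (term L (+ 0)) pos neg)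
                       (cong (binomℤ L) (trans (ZP.+-identityˡ _) (ZP.*-zeroʳ (+ m))))
    where
    pos : ∀ i → term L (+ 0) (+ suc i) ≡ 0
    pos i = binomℤ-big L (ZP.<-≤-trans (Z.+<+ L<m) (member-suc (+ 0) i))
    neg : ∀ i → term L (+ 0) -[1+ i ] ≡ 0
    neg i = binomℤ-neg L (ZP.≤-<-trans (member-neg (+ 0) i) (<⇒sub<0 m (Z.+<+ m≥1)))

  W : ℕ → ℤ → ℕ
  W L a = Σ< m (λ i → B L (a - + i))

  -- By periodicity a window may be slid by one.
  W-slide : ∀ L a → W L (a - + 1) ≡ W L a
  W-slide L a = NP.+-cancelʳ-≡ _ _ _ (begin
      W L (a - + 1) +ℕ B L a
    ≡⟨ cong₂ _+ℕ_ (Σ<-cong m (λ i _ → cong (B L) (shift a (+ i)))) (cong (B L) (sym (ZP.+-identityʳ a))) ⟩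
      Σ< m (λ i → h (suc i)) +ℕ h 0
    ≡⟨ Σ<-rotate m h ⟩
      W L a +ℕ B L (a - + m)
    ≡⟨ cong (W L a +ℕ_) (B-period⁻ L a) ⟩
      W L a +ℕ B L a ∎)
    where
    open ≡-Reasoning
    h : ℕ → ℕ
    h j = B L (a - + j)
    shift : ∀ a I → (a - + 1) - I ≡ a - (+ 1 + I)
    shift = solve-∀

  W-independent : ∀ L a → W L a ≡ W L (+ 0)
  W-independent L (+ zero) = refl
  W-independent L (+ suc n) = trans (sym (W-slide L (+ suc n))) (W-independent L (+ n))
  W-independent L -[1+ zero ] = W-slide L (+ 0)
  W-independent L -[1+ suc n ] =
    trans (cong (W L) (sym (pred-neg (+ n)))) (trans (W-slide L -[1+ n ]) (W-independent L -[1+ n ]))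
    where
    pred-neg : ∀ N → - (+ 1 + N) - + 1 ≡ - (+ 1 + (+ 1 + N))
    pred-neg = solve-∀

  -- For L = 0 only the class of 0 contributes, with C(0, 0) = 1.
  W-0 : W 0 (+ 0) ≡ 1
  W-0 = trans (split-first m m≥1) (cong₂ _+ℕ_ (B-at-0 0 m≥1) (Σ<-vanish (m ∸ 1) below))
    where
    h : ℕ → ℕ
    h i = B 0 (+ 0 - + i)
    split-first : ∀ k → 1 ≤ k → Σ< k h ≡ h 0 +ℕ Σ< (k ∸ 1) (λ i → h (suc i))
    split-first (suc k) _ = refl
    below : ∀ i → i N.< m ∸ 1 → B 0 -[1+ i ] ≡ 0
    below i i<m-1 = B-vanish-below 0 i
      (subst (suc (suc i) ≤_) (trans (NP.+-comm 1 (m ∸ 1)) (NP.m∸n+n≡m m≥1)) (s≤s i<m-1))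

  -- Any m consecutive classes together contain every C(L, k) exactly once.
  window : ∀ L a → W L a ≡ 2 ^ L
  window zero a = trans (W-independent 0 a) W-0
  window (suc L) a = begin
      Σ< m (λ i → B (suc L) (a - + i))
    ≡⟨ Σ<-cong m (λ i _ → trans (B-pascal L (a - + i))
                                  (cong (λ u → B L (a - + i) +ℕ B L u) (swap a (+ i)))) ⟩
      Σ< m (λ i → B L (a - + i) +ℕ B L ((a - + 1) - + i))
    ≡⟨ Σ<-+ m _ _ ⟩
      W L a +ℕ W L (a - + 1)
    ≡⟨ cong₂ _+ℕ_ (window L a) (window L (a - + 1)) ⟩
      2 ^ L +ℕ 2 ^ L
    ≡⟨ cong (2 ^ L +ℕ_) (sym (NP.+-identityʳ _)) ⟩
      2 ^ suc L ∎
    where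
    open ≡-Reasoning
    swap : ∀ a I → (a - I) - + 1 ≡ (a - + 1) - I
    swap = solve-∀

-- For the modulus 1 the class is the whole row of Pascal's triangle:
-- Σ_{t=-K}^{K} C(L, a + t) = 2^L when a, L ≤ K.
rowSum : ∀ K L a → a ≤ K → L ≤ K → sumRange K (λ t → binomℤ L (+ a + t)) ≡ 2 ^ L
rowSum K L a a≤K L≤K = begin
    sumRange K (λ t → binomℤ L (+ a + t))
  ≡⟨ cong sum (LP.map-cong (λ t → cong (λ u → binomℤ L (+ a + u)) (sym (ZP.*-identityˡ t))) (symRange K)) ⟩
    sumRange K (term L (+ a))
  ≡⟨ sumRange≡B K L a a≤K L≤K ⟩
    B L (+ a)
  ≡⟨ cong (B L) (sym (ZP.+-identityʳ (+ a))) ⟩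
    B L (+ a - + 0)
  ≡⟨ sym (NP.+-identityʳ _) ⟩
    W L (+ a)
  ≡⟨ window L (+ a) ⟩
    2 ^ L ∎
  where
  open ≡-Reasoning
  open ResidueSums 1 (s≤s z≤n)

module Chains (w : ℕ) where

  m : ℕ
  m = w +ℕ 2

  open ResidueSums m (NP.≤-trans (s≤s z≤n) (NP.m≤n+m 2 w)) public

  -- chains k x y is the number of z₁, …, z_k < w with z₁ ≤ x + 1, z_{i+1} ≤ z_i + 1
  -- and y ≤ z_k + 1: the ways to continue from x and reach y in k + 1 steps.
  chains : ℕ → ℕ → ℕ → ℕ
  chains zero x y = indicator (y N.≤? suc x)
  chains (suc k) x y = Σ< w (λ z → indicator (z N.≤? suc x) *ℕ chains k z y)

  -- In k + 1 steps one climbs at most k + 1.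
  chains-vanish : ∀ k z y → suc (k +ℕ z) N.< y → chains k z y ≡ 0
  chains-vanish zero z y p with y N.≤? suc z
  ... | yes q = ⊥-elim (NP.<⇒≱ p q)
  ... | no _ = refl
  chains-vanish (suc k) z y p = Σ<-vanish w (λ z' _ → term-vanish z')
    where
    term-vanish : ∀ z' → indicator (z' N.≤? suc z) *ℕ chains k z' y ≡ 0
    term-vanish z' with z' N.≤? suc z
    ... | no _ = refl
    ... | yes q = trans (NP.+-identityʳ _)
      (chains-vanish k z' y (NP.≤-<-trans (s≤s (subst (k +ℕ z' ≤_) (NP.+-suc k z) (NP.+-monoʳ-≤ k q))) p))

  -- The length of the lattice path behind chains k x y: L = 2k + 1 + x - y.
  len : ℕ → ℕ → ℕ → ℕ
  len k x y = suc (k +ℕ k +ℕ x) ∸ y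

  reflection : ℕ → ℕ → ℕ → ℤ
  reflection k y L = + B L (+ k) - + B L (+ k - + suc y)

  reflectionSum : ℕ → ℕ → ℕ → ℤ
  reflectionSum k y L = + B L (+ suc k) - + B L (+ k - + y)

  reflectionSum-pascal : ∀ k y L → reflectionSum k y (suc L) ≡ reflectionSum k y L + reflection k y L
  reflectionSum-pascal k y L = begin
      + B (suc L) (+ suc k) - + B (suc L) (+ k - + y)
    ≡⟨ cong₂ (λ a b → + a - + b) (B-pascal L (+ suc k))
         (trans (B-pascal L (+ k - + y)) (cong (λ u → B L (+ k - + y) +ℕ B L u) (shift (+ k) (+ y)))) ⟩
      + (B L (+ suc k) +ℕ B L (+ k)) - + (B L (+ k - + y) +ℕ B L (+ k - + suc y))
    ≡⟨ regroup (+ B L (+ suc k)) (+ B L (+ k)) (+ B L (+ k - + y)) (+ B L (+ k - + suc y)) ⟩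
      reflectionSum k y L + reflection k y L ∎
    where
    open ≡-Reasoning
    shift : ∀ K Y → (K - Y) - + 1 ≡ K - (+ 1 + Y)
    shift = solve-∀
    regroup : ∀ a b c d → (a + b) - (c + d) ≡ (a - c) + (b - d)
    regroup = solve-∀

  -- Moving the start from j to j + 1 lengthens the path by one, so the partial sum
  -- grows by the reflection count at j.
  reflectionSum-next : ∀ k y j → y ≤ suc (k +ℕ k +ℕ j) →
                       reflectionSum k y (len k (suc j) y)
                         ≡ reflectionSum k y (len k j y) + reflection k y (len k j y)
  reflectionSum-next k y j p = trans (cong (reflectionSum k y) len-suc) (reflectionSum-pascal k y (len k j y))
    where
    len-suc : len k (suc j) y ≡ suc (len k j y)
    len-suc = trans (cong (λ u → suc u ∸ y) (NP.+-suc (k +ℕ k) j)) (NP.+-∸-assoc 1 p)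

  -- Every end point y < w is reachable from the start w (the bound needed for x = w).
  <w⇒reachable : ∀ k y → y N.< w → y ≤ suc (k +ℕ k +ℕ w)
  <w⇒reachable k y y<w = NP.≤-trans (NP.<⇒≤ y<w) (NP.≤-trans (NP.m≤n+m w (k +ℕ k)) (NP.n≤1+n _))

  -- 2(k+1) + x = 2k + (x+2): one more step of the chain equals two more starts.
  double-suc : ∀ k x → suc k +ℕ suc k +ℕ x ≡ k +ℕ k +ℕ suc (suc x)
  double-suc = solve 2 (λ k x → (con 1 :+ k) :+ (con 1 :+ k) :+ x := k :+ k :+ (con 2 :+ x)) refl
    where open +-*-Solver

  -- The empty sum: for x = 0 the two classes k + 1 and k - y are mirror images.
  reflectionSum-0 : ∀ k y → y ≤ suc (k +ℕ k +ℕ 0) → reflectionSum k y (len k 0 y) ≡ + 0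
  reflectionSum-0 k y p =
    trans (cong (λ u → + B L (+ suc k) - + u) (B-sym L (+ k - + y)))
          (trans (cong (λ u → + B L (+ suc k) - + B L u) mirror) (ZP.+-inverseʳ (+ B L (+ suc k))))
    where
    L : ℕ
    L = len k 0 y
    reflect : ∀ K Y → ((+ 1 + (K + K + + 0)) - Y) - (K - Y) ≡ + 1 + K
    reflect = solve-∀
    mirror : + L - (+ k - + y) ≡ + suc k
    mirror = trans (cong (_- (+ k - + y)) (sym (pos-∸ p))) (reflect (+ k) (+ y))

  -- For y = 2k + 1 + x with x ≥ 1 the path has length 0, and neither of the classes
  -- k + 1 and k - y contains 0.
  reflectionSum-empty : ∀ k j y → y ≡ suc (k +ℕ k +ℕ suc j) → y N.< w →
                        reflectionSum k y (len k (suc j) y) ≡ + 0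
  reflectionSum-empty k j .(suc (k +ℕ k +ℕ suc j)) refl y<w rewrite NP.n∸n≡0 (suc (k +ℕ k +ℕ suc j)) =
    cong₂ (λ a b → + a - + b) (B-vanish-above 0 (suc k) (s≤s z≤n) k+1<m)
          (trans (cong (B 0) below) (B-vanish-below 0 (suc (k +ℕ j)) k+j+2<m))
    where
    y : ℕ
    y = suc (k +ℕ k +ℕ suc j)
    k+j+2≤y : suc (suc (k +ℕ j)) ≤ y
    k+j+2≤y = s≤s (subst (suc (k +ℕ j) ≤_) (sym (NP.+-suc (k +ℕ k) j)) (s≤s (NP.+-monoˡ-≤ j (NP.m≤m+n k k))))
    k+j+2<m : 0 +ℕ suc (suc (k +ℕ j)) N.< m
    k+j+2<m = NP.<-≤-trans (NP.≤-<-trans k+j+2≤y y<w) (NP.m≤m+n w 2)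
    k+1<m : suc k N.< m
    k+1<m = NP.≤-trans (s≤s (s≤s (NP.≤-trans (NP.m≤m+n k j) (NP.n≤1+n _)))) k+j+2<m
    difference : ∀ K J → K - (+ 1 + (K + K + (+ 1 + J))) ≡ - (+ 1 + (+ 1 + (K + J)))
    difference = solve-∀
    below : + k - + y ≡ -[1+ suc (k +ℕ j) ]
    below = difference (+ k) (+ j)

  -- A start x = w is out of range: its reflection count vanishes, the two classes
  -- being mirror images up to a period m = w + 2.
  reflection-at-w : ∀ k y → y N.< w → reflection k y (len k w y) ≡ + 0
  reflection-at-w k y y<w =
    trans (cong (λ u → + B L (+ k) - + u)
                (trans (B-sym L (+ k - + suc y)) (trans (cong (B L) mirror) (B-period L (+ k)))))
          (ZP.+-inverseʳ (+ B L (+ k)))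
    where
    L : ℕ
    L = len k w y
    reflect : ∀ K W Y → ((+ 1 + (K + K + W)) - Y) - (K - (+ 1 + Y)) ≡ K + (W + + 2)
    reflect = solve-∀
    mirror : + L - (+ k - + suc y) ≡ + k + + m
    mirror = trans (cong (_- (+ k - + suc y)) (sym (pos-∸ (<w⇒reachable k y y<w))))
                   (reflect (+ k) (+ w) (+ y))

  ReflectionFormula : ℕ → Set
  ReflectionFormula k = ∀ x y → x N.< w → y N.< w → y ≤ suc (k +ℕ k +ℕ x) →
                        + chains k x y ≡ reflection k y (len k x y)

  -- Given the formula for k, the partial sums Σ_{z<j} chains k z y telescope.
  prefix-sums : ∀ k y → y N.< w → ReflectionFormula k → ∀ j → j ≤ w → y ≤ suc (k +ℕ k +ℕ j) →
                + Σ< j (λ z → chains k z y) ≡ reflectionSum k y (len k j y)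
  prefix-sums k y y<w formula zero _ p = sym (reflectionSum-0 k y p)
  prefix-sums k y y<w formula (suc j) j<w p with y N.≤? suc (k +ℕ k +ℕ j)
  ... | yes q = begin
        + Σ< (suc j) g
      ≡⟨ cong +_ (Σ<-last j g) ⟩
        + Σ< j g + + chains k j y
      ≡⟨ cong₂ _+_ (prefix-sums k y y<w formula j (NP.<⇒≤ j<w) q) (formula j y j<w y<w q) ⟩
        reflectionSum k y (len k j y) + reflection k y (len k j y)
      ≡⟨ sym (reflectionSum-next k y j q) ⟩
        reflectionSum k y (len k (suc j) y) ∎
    where
    open ≡-Reasoning
    g : ℕ → ℕ
    g z = chains k z y
  ... | no ¬q = trans (cong +_ (Σ<-vanish (suc j) (λ z z≤j → chains-vanish k z y (too-high z z≤j))))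
                      (sym (reflectionSum-empty k j y y≡ y<w))
    where
    above : suc (suc (k +ℕ k +ℕ j)) ≤ y
    above = NP.≰⇒> ¬q
    y≡ : y ≡ suc (k +ℕ k +ℕ suc j)
    y≡ = NP.≤-antisym p (subst (_≤ y) (cong suc (sym (NP.+-suc (k +ℕ k) j))) above)
    too-high : ∀ z → z N.< suc j → suc (k +ℕ z) N.< y
    too-high z (s≤s z≤j) =
      NP.≤-trans (s≤s (s≤s (NP.≤-trans (NP.+-monoʳ-≤ k z≤j) (NP.+-monoˡ-≤ j (NP.m≤m+n k k))))) above

  -- Length 0: for L = x + 1 - y < m the class of 0 contributes C(L, 0) = 1 and the
  -- class of -(y + 1) nothing.
  reflection-base : ReflectionFormula 0
  reflection-base x y x<w y<w p with y N.≤? suc x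
  ... | no y≰ = ⊥-elim (y≰ p)
  ... | yes _ = sym (cong₂ (λ a b → + a - + b) (B-at-0 L L<m) (B-vanish-below L y small))
    where
    L : ℕ
    L = suc x ∸ y
    w+2 : suc (suc w) ≡ m
    w+2 = NP.+-comm 2 w
    L<m : L N.< m
    L<m = subst (suc L ≤_) w+2 (s≤s (NP.≤-trans (NP.m∸n≤m (suc x) y) (NP.≤-trans x<w (NP.n≤1+n w))))
    small : L +ℕ suc y N.< m
    small = subst (_≤ m) (cong suc (sym (trans (NP.+-suc L y) (cong suc (NP.m∸n+n≡m p)))))
                  (subst (suc (suc (suc x)) ≤_) w+2 (s≤s (s≤s x<w)))

  reflectionSum≡reflection : ∀ k x y →
                             reflectionSum k y (len k (suc (suc x)) y) ≡ reflection (suc k) y (len (suc k) x y)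
  reflectionSum≡reflection k x y =
    cong₂ (λ L c → + B L (+ suc k) - + B L c)
          (cong (λ u → suc u ∸ y) (sym (double-suc k x))) (shift (+ k) (+ y))
    where
    shift : ∀ K Y → K - Y ≡ (+ 1 + K) - (+ 1 + Y)
    shift = solve-∀

  -- The next step: chains (k+1) x y sums chains k z y over z < min(x + 2, w); when
  -- x + 2 > w, i.e. x = w - 1, the missing start z = w contributes nothing.
  reflection-step : ∀ k → ReflectionFormula k → ReflectionFormula (suc k)
  reflection-step k formula x y x<w y<w p = begin
      + chains (suc k) x y
    ≡⟨ cong +_ (Σ<-indicator w (suc x) g) ⟩
      + Σ< (suc (suc x) ⊓ w) g
    ≡⟨ truncate-at (suc (suc x) N.≤? w) ⟩
      reflectionSum k y (len k (suc (suc x)) y)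
    ≡⟨ reflectionSum≡reflection k x y ⟩
      reflection (suc k) y (len (suc k) x y) ∎
    where
    open ≡-Reasoning
    g : ℕ → ℕ
    g z = chains k z y
    y≤w' : y ≤ suc (k +ℕ k +ℕ w)
    y≤w' = <w⇒reachable k y y<w
    truncate-at : Dec (suc (suc x) ≤ w) →
                  + Σ< (suc (suc x) ⊓ w) g ≡ reflectionSum k y (len k (suc (suc x)) y)
    truncate-at (yes x+2≤w) = trans (cong (λ u → + Σ< u g) (NP.m≤n⇒m⊓n≡m x+2≤w))
      (prefix-sums k y y<w formula (suc (suc x)) x+2≤w (subst (λ u → y ≤ suc u) (double-suc k x) p))
    truncate-at (no x+2≰w) = begin
        + Σ< (suc (suc x) ⊓ w) g
      ≡⟨ cong (λ u → + Σ< u g) (NP.m≥n⇒m⊓n≡n (NP.<⇒≤ (NP.≰⇒> x+2≰w))) ⟩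
        + Σ< w g
      ≡⟨ prefix-sums k y y<w formula w NP.≤-refl y≤w' ⟩
        reflectionSum k y (len k w y)
      ≡⟨ sym (ZP.+-identityʳ _) ⟩
        reflectionSum k y (len k w y) + + 0
      ≡⟨ cong (λ u → reflectionSum k y (len k w y) + u) (sym (reflection-at-w k y y<w)) ⟩
        reflectionSum k y (len k w y) + reflection k y (len k w y)
      ≡⟨ sym (reflectionSum-next k y w y≤w') ⟩
        reflectionSum k y (len k (suc w) y)
      ≡⟨ cong (λ u → reflectionSum k y (len k (suc u) y)) w≡x+1 ⟩
        reflectionSum k y (len k (suc (suc x)) y) ∎
      where
      w≡x+1 : w ≡ suc x
      w≡x+1 = NP.≤-antisym (N.s≤s⁻¹ (NP.≰⇒> x+2≰w)) x<w

  reflection-formula : ∀ k → ReflectionFormula k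
  reflection-formula zero = reflection-base
  reflection-formula (suc k) = reflection-step k (reflection-formula k)

  -- Closed chains (y = x): the path length is L₀ = 2k + 1 whatever x is.
  module ClosedChains (k : ℕ) where

    L₀ : ℕ
    L₀ = suc (k +ℕ k)

    b : ℕ
    b = B L₀ (+ k)

    below : ℕ
    below = Σ< w (λ x → B L₀ (+ k - + suc x))

    -- By the reflection formula, chains k x x = b - B(2k+1, k - x - 1).
    closed+below : Σ< w (λ x → chains k x x) +ℕ below ≡ w *ℕ b
    closed+below = trans (sym (Σ<-+ w _ _)) (trans (Σ<-cong w pointwise) (Σ<-const w b))
      where
      pointwise : ∀ x → x N.< w → chains k x x +ℕ B L₀ (+ k - + suc x) ≡ b
      pointwise x x<w = ZP.+-injective (trans (cong (_+ + tail) formula) (cancel (+ b) (+ tail)))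
        where
        tail : ℕ
        tail = B L₀ (+ k - + suc x)
        x≤ : x ≤ suc (k +ℕ k +ℕ x)
        x≤ = NP.≤-trans (NP.n≤1+n x) (s≤s (NP.m≤n+m x (k +ℕ k)))
        formula : + chains k x x ≡ + b - + tail
        formula = trans (reflection-formula k x x x<w x<w x≤) (cong (reflection k x) (NP.m+n∸n≡m L₀ x))
        cancel : ∀ a c → (a - c) + c ≡ a
        cancel = solve-∀

    -- The classes k and k + 1 of the odd length 2k + 1 are mirror images.
    B-middle : B L₀ (+ suc k) ≡ b
    B-middle = trans (B-sym L₀ (+ suc k)) (cong (B L₀) (mirror (+ k)))
      where
      mirror : ∀ K → (+ 1 + (K + K)) - (+ 1 + K) ≡ K
      mirror = solve-∀

    -- The window of the m = w + 2 classes k + 1, k, k - 1, …, k - w.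
    window-middle : b +ℕ (b +ℕ below) ≡ 2 ^ L₀
    window-middle = trans (sym as-window) (window L₀ (+ suc k))
      where
      shift : ∀ K I → (+ 1 + K) - (+ 1 + (+ 1 + I)) ≡ K - (+ 1 + I)
      shift = solve-∀
      as-window : W L₀ (+ suc k) ≡ b +ℕ (b +ℕ below)
      as-window = trans (cong (λ u → Σ< u (λ i → B L₀ (+ suc k - + i))) (NP.+-comm w 2))
        (cong₂ _+ℕ_ (trans (cong (B L₀) (ZP.+-identityʳ (+ suc k))) B-middle)
                    (cong (b +ℕ_) (Σ<-cong w (λ i _ → cong (B L₀) (shift (+ k) (+ i))))))

    closed-count : + Σ< w (λ x → chains k x x) ≡ + m * + b - + (2 ^ L₀)
    closed-count = begin
        + C
      ≡⟨ add-sub (+ C) (+ below) ⟩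
        (+ C + + below) - + below
      ≡⟨ cong (λ u → + u - + below) closed+below ⟩
        + (w *ℕ b) - + below
      ≡⟨ cong (_- + below) (ZP.pos-* w b) ⟩
        + w * + b - + below
      ≡⟨ regroup (+ w) (+ b) (+ below) ⟩
        (+ w + + 2) * + b - (+ b + (+ b + + below))
      ≡⟨ cong (λ u → (+ w + + 2) * + b - + u) window-middle ⟩
        + m * + b - + (2 ^ L₀) ∎
      where
      open ≡-Reasoning
      C : ℕ
      C = Σ< w (λ x → chains k x x)
      add-sub : ∀ c r → c ≡ (c + r) - r
      add-sub = solve-∀
      regroup : ∀ W B R → W * B - R ≡ (W + + 2) * B - (B + (B + R))
      regroup = solve-∀

prop↔Fin : ∀ {P : Set} → Irrelevant P → (d : Dec P) → P ↔ Fin (indicator d)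
prop↔Fin irr (yes p) = mk↔ₛ′ (λ _ → zero) (λ _ → p) (λ { zero → refl }) (irr p)
prop↔Fin irr (no ¬p) = mk↔ₛ′ (λ p → ⊥-elim (¬p p)) (λ ()) (λ ()) (λ p → ⊥-elim (¬p p))

Σ<↔Fin : ∀ k {A : ℕ → Set} {f : ℕ → ℕ} → (∀ z → z N.< k → A z ↔ Fin (f z)) →
         Σ ℕ (λ z → z N.< k × A z) ↔ Fin (Σ< k f)
Σ<↔Fin zero h = mk↔ₛ′ (λ { (z , () , _) }) (λ ()) (λ ()) (λ { (z , () , _) })
Σ<↔Fin (suc k) {A} h =
  ↔-trans split (↔-trans (h 0 (s≤s z≤n) ⊎-↔ Σ<↔Fin k (λ z p → h (suc z) (s≤s p))) (↔-sym +↔⊎))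
  where
  split : Σ ℕ (λ z → z N.< suc k × A z) ↔ (A 0 ⊎ Σ ℕ (λ z → z N.< k × A (suc z)))
  split = mk↔ₛ′
    (λ { (zero , _ , a) → inj₁ a ; (suc z , s≤s p , a) → inj₂ (z , p , a) })
    (λ { (inj₁ a) → (0 , s≤s z≤n , a) ; (inj₂ (z , p , a)) → (suc z , s≤s p , a) })
    (λ { (inj₁ a) → refl ; (inj₂ (z , p , a)) → refl })
    (λ { (zero , s≤s z≤n , a) → refl ; (suc z , s≤s p , a) → refl })

Chain : ℕ → ∀ {k} → Vec ℕ k → ℕ → Set
Chain x [] y = y ≤ suc x
Chain x (z ∷ r) y = z ≤ suc x × Chain z r y

Chain-irrelevant : ∀ x {k} (r : Vec ℕ k) y → Irrelevant (Chain x r y)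
Chain-irrelevant x [] y = NP.≤-irrelevant
Chain-irrelevant x (z ∷ r) y (p , c) (q , d) = cong₂ _,_ (NP.≤-irrelevant p q) (Chain-irrelevant z r y c d)

Chain⇒steps : ∀ {k} x (r : Vec ℕ k) y → Chain x r y → ∀ i → lookup (r ∷ʳ y) i ≤ suc (lookup (x ∷ r) i)
Chain⇒steps x [] y c zero = c
Chain⇒steps x (z ∷ r) y (q , c) zero = q
Chain⇒steps x (z ∷ r) y (q , c) (suc i) = Chain⇒steps z r y c i

steps⇒Chain : ∀ {k} x (r : Vec ℕ k) y → (∀ i → lookup (r ∷ʳ y) i ≤ suc (lookup (x ∷ r) i)) → Chain x r y
steps⇒Chain x [] y h = h zero
steps⇒Chain x (z ∷ r) y h = h zero , steps⇒Chain z r y (λ i → h (suc i))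

lookup-next : ∀ {k} x (r : Vec ℕ k) (i : Fin (suc k)) → lookup (x ∷ r) (next i) ≡ lookup (r ∷ʳ x) i
lookup-next {k} x r i = go (Top.view i)
  where
  toℕ-next : ∀ (i : Fin (suc k)) → toℕ (next i) ≡ suc (toℕ i) % suc k
  toℕ-next i = FP.toℕ-fromℕ< _
  lookup-∷ʳ-inject₁ : ∀ {k} (r : Vec ℕ k) (j : Fin k) → lookup (r ∷ʳ x) (inject₁ j) ≡ lookup r j
  lookup-∷ʳ-inject₁ (z ∷ r) zero = refl
  lookup-∷ʳ-inject₁ (z ∷ r) (suc j) = lookup-∷ʳ-inject₁ r j
  lookup-∷ʳ-last : ∀ {k} (r : Vec ℕ k) → lookup (r ∷ʳ x) (fromℕ k) ≡ x
  lookup-∷ʳ-last [] = refl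
  lookup-∷ʳ-last (z ∷ r) = lookup-∷ʳ-last r
  go : ∀ {i} → Top.View i → lookup (x ∷ r) (next i) ≡ lookup (r ∷ʳ x) i
  go Top.‵fromℕ = trans (cong (lookup (x ∷ r)) next-last) (sym (lookup-∷ʳ-last r))
    where
    next-last : next (fromℕ k) ≡ zero
    next-last = FP.toℕ-injective (trans (toℕ-next _)
      (trans (cong (λ u → suc u % suc k) (FP.toℕ-fromℕ k)) (n%n≡0 (suc k))))
  go (Top.‵inject₁ j) = trans (cong (lookup (x ∷ r)) next-inject₁) (sym (lookup-∷ʳ-inject₁ r j))
    where
    next-inject₁ : next (inject₁ j) ≡ suc j
    next-inject₁ = FP.toℕ-injective (trans (toℕ-next _)
      (trans (cong (λ u → suc u % suc k) (FP.toℕ-inject₁ j)) (m<n⇒m%n≡m (s≤s (FP.toℕ<n j)))))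

Cyclic : ∀ {k} → Vec ℕ (suc k) → Set
Cyclic {k} a = All (λ i → lookup a (next i) ≤ suc (lookup a i)) (allFin (suc k))

Cyclic⇒Chain : ∀ {k} x (r : Vec ℕ k) → Cyclic (x ∷ r) → Chain x r x
Cyclic⇒Chain x r cyc = steps⇒Chain x r x
  (λ i → subst (_≤ suc (lookup (x ∷ r) i)) (lookup-next x r i) (AllP.tabulate⁻ {f = λ j → j} cyc i))

Chain⇒Cyclic : ∀ {k} x (r : Vec ℕ k) → Chain x r x → Cyclic (x ∷ r)
Chain⇒Cyclic x r c = AllP.tabulate⁺ {f = λ j → j}
  (λ i → subst (_≤ suc (lookup (x ∷ r) i)) (sym (lookup-next x r i)) (Chain⇒steps x r x c i))

module Enumeration (w : ℕ) where

  open Chains w using (chains)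

  BoundedChains : ℕ → ℕ → ℕ → Set
  BoundedChains k x y = Σ (Vec ℕ k) (λ r → All (N._< w) r × Chain x r y)

  -- Choosing the entries one at a time realises the recursion defining chains.
  BoundedChains↔Fin : ∀ k x y → BoundedChains k x y ↔ Fin (chains k x y)
  BoundedChains↔Fin zero x y = ↔-trans empty (prop↔Fin NP.≤-irrelevant (y N.≤? suc x))
    where
    empty : BoundedChains 0 x y ↔ (y ≤ suc x)
    empty = mk↔ₛ′ (λ { ([] , [] , c) → c }) (λ c → ([] , [] , c)) (λ _ → refl) (λ { ([] , [] , c) → refl })
  BoundedChains↔Fin (suc k) x y = ↔-trans first (Σ<↔Fin w next-entry)
    where
    next-entry : ∀ z → z N.< w →
                 ((z ≤ suc x) × BoundedChains k z y) ↔ Fin (indicator (z N.≤? suc x) *ℕ chains k z y)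
    next-entry z _ =
      ↔-trans (prop↔Fin NP.≤-irrelevant (z N.≤? suc x) ×-↔ BoundedChains↔Fin k z y) (↔-sym *↔×)
    first : BoundedChains (suc k) x y ↔ Σ ℕ (λ z → z N.< w × ((z ≤ suc x) × BoundedChains k z y))
    first = mk↔ₛ′
      (λ { ((z ∷ r) , (z<w ∷ r<w) , (q , c)) → (z , z<w , (q , (r , r<w , c))) })
      (λ { (z , z<w , (q , (r , r<w , c))) → ((z ∷ r) , (z<w ∷ r<w) , (q , c)) })
      (λ _ → refl)
      (λ { ((z ∷ r) , (z<w ∷ r<w) , (q , c)) → refl })

  CDP↔closedChains : ∀ k → CDP (suc k) w ↔ Σ ℕ (λ x → x N.< w × BoundedChains k x x)
  CDP↔closedChains k = mk↔ₛ′
    (λ { ((x ∷ r) , (x<w ∷ r<w) , cyc) → (x , x<w , (r , r<w , Cyclic⇒Chain x r cyc)) })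
    (λ { (x , x<w , (r , r<w , c)) → ((x ∷ r) , (x<w ∷ r<w) , Chain⇒Cyclic x r c) })
    (λ { (x , x<w , (r , r<w , c)) → cong (λ u → (x , x<w , (r , r<w , u))) (Chain-irrelevant x r x _ _) })
    (λ { ((x ∷ r) , (x<w ∷ r<w) , cyc) →
           cong (λ u → ((x ∷ r) , (x<w ∷ r<w) , u)) (All.irrelevant NP.≤-irrelevant _ _) })

  CDP↔Fin : ∀ k → CDP (suc k) w ↔ Fin (Σ< w (λ x → chains k x x))
  CDP↔Fin k = ↔-trans (CDP↔closedChains k) (Σ<↔Fin w (λ x _ → BoundedChains↔Fin k x x))

lemma3p7 : (n w : ℕ) → 1 ≤ n → 1 ≤ w →
    Σ ℕ (λ m → (CDP n w ↔ Fin m) ×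
      ((+ m ≡ (+ (w +ℕ 2)) * (+ sumRange (2 *ℕ n) (λ t → binomℤ (2 *ℕ n ∸ 1) (+ n + (+ (w +ℕ 2)) * t)))
               - (+ sumRange (2 *ℕ n) (λ t → binomℤ (2 *ℕ n ∸ 1) (+ n + t)))) ×
       ((+ (w +ℕ 2)) * (+ sumRange (2 *ℕ n) (λ t → binomℤ (2 *ℕ n ∸ 1) (+ n + (+ (w +ℕ 2)) * t)))
               - (+ sumRange (2 *ℕ n) (λ t → binomℤ (2 *ℕ n ∸ 1) (+ n + t)))
         ≡ (+ (w +ℕ 2)) * (+ sumRange (2 *ℕ n) (λ t → binomℤ (2 *ℕ n ∸ 1) (+ n + (+ (w +ℕ 2)) * t)))
               - (+ (2 ^ (2 *ℕ n ∸ 1))))))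
lemma3p7 zero w () _
lemma3p7 (suc k) w _ _ =
  Σ< w (λ x → chains k x x) , CDP↔Fin k , count , cong (λ v → + m * + central-sum - + v) row
  where
  open Chains w
  open ClosedChains k
  open Enumeration w
  n : ℕ
  n = suc k
  central-sum row-sum : ℕ
  central-sum = sumRange (2 *ℕ n) (term (2 *ℕ n ∸ 1) (+ n))
  row-sum = sumRange (2 *ℕ n) (λ t → binomℤ (2 *ℕ n ∸ 1) (+ n + t))
  length : 2 *ℕ n ∸ 1 ≡ L₀
  length = trans (cong (k +ℕ_) (NP.+-identityʳ n)) (NP.+-suc k k)
  L≤2n : 2 *ℕ n ∸ 1 ≤ 2 *ℕ n
  L≤2n = NP.m∸n≤m (2 *ℕ n) 1
  n≤2n : n ≤ 2 *ℕ n
  n≤2n = NP.m≤m+n n (n +ℕ 0)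
  central : central-sum ≡ b
  central = trans (sumRange≡B (2 *ℕ n) (2 *ℕ n ∸ 1) n n≤2n L≤2n) (trans (cong (λ L → B L (+ n)) length) B-middle)
  row : row-sum ≡ 2 ^ (2 *ℕ n ∸ 1)
  row = rowSum (2 *ℕ n) (2 *ℕ n ∸ 1) n n≤2n L≤2n
  count : + Σ< w (λ x → chains k x x) ≡ + m * + central-sum - + row-sum
  count = trans closed-count (cong₂ (λ u v → + m * + u - + v) (sym central) (sym (trans row (cong (2 ^_) length))))
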